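{- Let $\mathcal{F}$ be a list of $nkm$-lists all of which are entries of $\mathrm{families}(n,k,m)$, and let $P$ be a list all of whose entries are permutations of $[0,1,\dots,n-1]$. If every family represented by an entry of $\mathrm{nef}(\mathcal{F},P)$ is an FC-family, then every family represented by an entry of $\mathcal{F}$ is an FC-family.
   Context: An $nkm$-list is a lexicographically sorted list without repetitions of length $m$ of sorted lists without repetitions of length $k$ with entries in $\{0,\dots,n-1\}$; it represents the family of the sets of its entries. $\mathrm{families}(n,k,m)$ is the list of all $nkm$-lists (all sorted $m$-element sublists of the list of all sorted $k$-element sublists of $[0,\dots,n-1]$). $\mathrm{perm\_set}(A,p)=\mathrm{sort}(\mathrm{map}(\lambda x.\ p!x)\ A)$ with $p!x$ the $x$-th entry of $p$; $\mathrm{perm\_family}(F,p)=\mathrm{sort}(\mathrm{map}(\lambda A.\ \mathrm{perm\_set}(A,p))\ F)$. $\mathrm{nef}'([\,],P,\mathcal{F}_r)=\mathcal{F}_r$; $\mathrm{nef}'(F\#\mathcal{F}',P,\mathcal{F}_r)=\mathrm{nef}'(\mathrm{filter}(\lambda G.\ G\notin\mathcal{F}_F^P)(F\#\mathcal{F}'),P,F\#\mathcal{F}_r)$ with $\mathcal{F}_F^P=\mathrm{remdups}(\mathrm{map}(\lambda p.\ \mathrm{perm\_family}(F,p))\ P)$; $\mathrm{nef}(\mathcal{F},P)=\mathrm{nef}'(\mathcal{F},P,[\,])$. A family $G_c$ is an FC-family if every finite union closed family $G\supseteq G_c$ (i.e., $A\cup B\in G$ for all $A,B\in G$) has an element $a\in\bigcup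 G$ with $2\cdot|\{A\in G:a\in A\}|\ge|G|$. -}

module Defs where

open import Data.Nat using (ℕ; zero; suc; _<_; _*_; _≤_)
open import Data.Nat.Properties as ℕP using ()
open import Data.List using (List; []; _∷_; _++_; map; length; filter; upTo)
open import Data.List.Properties using (≡-dec)
open import Data.List.Relation.Unary.Linked using (Linked)
open import Data.List.Relation.Unary.Unique.Propositional using (Unique)
open import Data.List.Relation.Unary.All using (All)
open import Data.List.Membership.Propositional using (_∈_)
import Data.List.Membership.DecPropositional as DecMem
import Data.List.Relation.Binary.Lex.NonStrict as Lex
import Data.List.Sort.InsertionSort.Base as ISort
open import Data.Product using (Σ; _×_; ∃)
open import Data.Sum using (_⊎_)
open import Relation.Nullary using (¬_)
open import Function.Bundles using (_⇔_)

sortℕ : List ℕ → List ℕ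
sortℕ = ISort.sort ℕP.≤-decTotalOrder

sortLex : List (List ℕ) → List (List ℕ)
sortLex = ISort.sort (Lex.≤-decTotalOrder ℕP.≤-decTotalOrder)

-- all sorted k-element sublists of a list, in lexicographic order
-- (when the input list is sorted)
sublists : {A : Set} → ℕ → List A → List (List A)
sublists zero    xs       = [] ∷ []
sublists (suc k) []       = []
sublists (suc k) (x ∷ xs) = map (x ∷_) (sublists k xs) ++ sublists (suc k) xs

families : ℕ → ℕ → ℕ → List (List (List ℕ))
families n k m = sublists m (sublists k (upTo n))

-- p ! x : the x-th entry of p (0 if out of range; never used out of range here)
_!_ : List ℕ → ℕ → ℕ
[]      ! _       = 0
(y ∷ _) ! zero    = y
(_ ∷ p) ! (suc x) = p ! x

IsPermutation : ℕ → List ℕ → Set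
IsPermutation n p = p ↭ upTo n
  where open import Data.List.Relation.Binary.Permutation.Propositional using (_↭_)

perm-set : List ℕ → List ℕ → List ℕ
perm-set A p = sortℕ (map (λ x → p ! x) A)

perm-family : List (List ℕ) → List ℕ → List (List ℕ)
perm-family F p = sortLex (map (λ A → perm-set A p) F)

open DecMem (≡-dec (≡-dec ℕP._≟_)) using () renaming (_∈?_ to _∈F?_)

removeDups : List (List (List ℕ)) → List (List (List ℕ))
removeDups = Data.List.deduplicate (≡-dec (≡-dec ℕP._≟_))
  where import Data.List

orbit : List (List ℕ) → List (List ℕ) → List (List (List ℕ))
orbit F P = removeDups (map (perm-family F) P)

-- nef' with a fuel argument; fuel = length of the list
-- always suffices, as every step removes at least the head.
nef′ : ℕ → List (List (List ℕ)) → List (List ℕ) → List (List (List ℕ))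
     → List (List (List ℕ))
nef′ zero       _        _ Fr = Fr
nef′ (suc fuel) []       P Fr = Fr
nef′ (suc fuel) (F ∷ Fs) P Fr =
  nef′ fuel (filter (λ G → Relation.Nullary.¬? (G ∈F? orbit F P)) Fs) P (F ∷ Fr)
  where import Relation.Nullary

nef : List (List (List ℕ)) → List (List ℕ) → List (List (List ℕ))
nef 𝓕 P = nef′ (length 𝓕) 𝓕 P []

-- FC-families
-- A (finite) set of naturals is represented canonically by a strictly
-- increasing list; a finite family of such sets by a duplicate-free list
-- of canonical lists.

CanonSet : List ℕ → Set
CanonSet = Linked _<_

_≈ₛ_ : List ℕ → List ℕ → Set
A ≈ₛ B = ∀ x → (x ∈ A) ⇔ (x ∈ B)

UnionClosed : List (List ℕ) → Set
UnionClosed G = ∀ A B → A ∈ G → B ∈ G →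
  Σ (List ℕ) λ C → C ∈ G × (∀ x → (x ∈ C) ⇔ (x ∈ A ⊎ x ∈ B))

Includes : List (List ℕ) → List (List ℕ) → Set
Includes G Gc = ∀ A → A ∈ Gc → Σ (List ℕ) λ B → B ∈ G × B ≈ₛ A

count : ℕ → List (List ℕ) → ℕ
count a G = length (filter (λ A → a ∈ℕ? A) G)
  where open DecMem ℕP._≟_ using () renaming (_∈?_ to _∈ℕ?_)

IsFCFamily : List (List ℕ) → Set
IsFCFamily Gc = ∀ (G : List (List ℕ)) → All CanonSet G → Unique G →
  UnionClosed G → Includes G Gc →
  Σ ℕ λ a → (Σ (List ℕ) λ A → A ∈ G × a ∈ A) × (length G ≤ 2 * count a G)

-- Lemma 7: nef(𝓕, P) keeps one representative of every P-orbit of 𝓕, so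
-- if all the representatives are FC-families, so is every member of 𝓕.
--
-- The mathematical content is that being an FC-family is invariant under
-- relabelling the ground set by a bijection σ of ℕ: if F is an FC-family
-- and F′ contains a σ-image of every member of F, then F′ is an
-- FC-family.  Indeed, pulling a union closed G ⊇ F′ back along σ gives a
-- union closed family ⊇ F of the same size, and the element a it provides
-- gives σ a for G, which lies in exactly as many members.
module Submission where

open import Defs
open import Data.List using (List; []; _∷_; map; length; filter; upTo)
open import Data.Nat.ListAction using (sum)
open import Data.Nat using (ℕ; zero; suc; _<_; _≤_; _*_; z≤n; s≤s; _<?_)
import Data.Nat.Properties as NP
open import Data.List.Properties using (≡-dec; length-map; length-upTo; length-filter)
open import Data.List.Relation.Unary.All as All using (All; []; _∷_)
open import Data.List.Relation.Unary.All.Properties as AllP using ()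
open import Data.List.Relation.Unary.Any using (here; there)
open import Data.List.Relation.Unary.AllPairs using ([]; _∷_)
open import Data.List.Relation.Unary.Linked using ([]; [-]; _∷_)
import Data.List.Relation.Unary.Linked as Linked
import Data.List.Relation.Unary.Linked.Properties as LinkedP
open import Data.List.Relation.Unary.Unique.Propositional using (Unique)
open import Data.List.Membership.Propositional using (_∈_)
open import Data.List.Membership.Propositional.Properties
open import Data.List.Relation.Binary.Permutation.Propositional using (↭⇒↭ₛ; ↭-sym)
import Data.List.Relation.Binary.Permutation.Propositional.Properties as PermP
import Data.List.Relation.Binary.Permutation.Setoid.Properties as PermSP
import Data.List.Relation.Unary.Unique.Propositional.Properties as UniqueP
import Data.List.Membership.DecPropositional as DecMem
import Data.List.Sort.InsertionSort.Properties as SortP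
import Data.List.Relation.Binary.Lex.NonStrict as Lex
open import Data.Product using (_×_; ∃; _,_; proj₂)
open import Data.Sum using (inj₁; inj₂)
open import Data.Sum.Function.Propositional using (_⊎-⇔_)
open import Data.Empty using (⊥-elim)
open import Relation.Nullary using (¬_; ¬?; Dec; yes; no)
open import Relation.Binary.PropositionalEquality
open import Function.Base using (id)
open import Function.Bundles using (_⇔_; mk⇔; Equivalence; _↔_; Inverse; mk⤖)
open import Function.Properties.Bijection using (⤖⇒↔)
open import Function.Properties.Equivalence using () renaming (trans to ⇔-trans; sym to ⇔-sym)
open import Function.Consequences.Propositional using (strictlySurjective⇒surjective)

open DecMem NP._≟_ using () renaming (_∈?_ to _∈ℕ?_)
open DecMem (≡-dec (≡-dec NP._≟_)) using () renaming (_∈?_ to _∈F?_)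

open Equivalence using (to; from)

head<tail : ∀ {x xs} → CanonSet (x ∷ xs) → All (x <_) xs
head<tail [-]     = []
head<tail (r ∷ l) = LinkedP.Linked⇒All NP.<-trans r l

-- An element of the tail differs from the head, so it survives removal of
-- the head from any other list.
drop-head : ∀ {x z xs ys} → CanonSet (x ∷ xs) → z ∈ xs → z ∈ x ∷ ys → z ∈ ys
drop-head c z∈xs (here refl) = ⊥-elim (NP.<-irrefl refl (All.lookup (head<tail c) z∈xs))
drop-head c _    (there z∈ys) = z∈ys

canon-ext : ∀ {A B} → CanonSet A → CanonSet B → A ≈ₛ B → A ≡ B
canon-ext {[]}    {[]}    _ _ _ = refl
canon-ext {[]}    {y ∷ _} _ _ A≈B with from (A≈B y) (here refl)
... | ()
canon-ext {x ∷ _} {[]}    _ _ A≈B with to (A≈B x) (here refl)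
... | ()
canon-ext {x ∷ xs} {y ∷ ys} cA cB A≈B
  with heads-equal (to (A≈B x) (here refl)) (from (A≈B y) (here refl))
  where
  heads-equal : x ∈ y ∷ ys → y ∈ x ∷ xs → x ≡ y
  heads-equal (here x≡y) _            = x≡y
  heads-equal (there _)  (here y≡x)   = sym y≡x
  heads-equal (there x∈) (there y∈) =
    ⊥-elim (NP.<-asym (All.lookup (head<tail cB) x∈) (All.lookup (head<tail cA) y∈))
... | refl = cong (x ∷_) (canon-ext (Linked.tail cA) (Linked.tail cB) λ z → mk⇔
  (λ z∈xs → drop-head cA z∈xs (to (A≈B z) (there z∈xs)))
  (λ z∈ys → drop-head cB z∈ys (from (A≈B z) (there z∈ys))))

sublists-⊆ : ∀ {A : Set} k (xs : List A) {X} → X ∈ sublists k xs → All (_∈ xs) X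
sublists-⊆ zero    xs       (here refl) = []
sublists-⊆ (suc k) (x ∷ xs) X∈ with ∈-++⁻ (map (x ∷_) (sublists k xs)) X∈
... | inj₂ X∈rest = All.map there (sublists-⊆ (suc k) xs X∈rest)
... | inj₁ X∈with-x with ∈-map⁻ (x ∷_) X∈with-x
...   | Y , Y∈ , refl = here refl ∷ All.map there (sublists-⊆ k xs Y∈)

families-bounded : ∀ n k m {F} → F ∈ families n k m → All (All (_< n)) F
families-bounded n k m F∈ =
  All.map (λ A∈ → All.map ∈-upTo⁻ (sublists-⊆ k (upTo n) A∈))
          (sublists-⊆ m (sublists k (upTo n)) F∈)

∈⇒≤sum : ∀ {y A} → y ∈ A → y ≤ sum A
∈⇒≤sum {A = x ∷ A} (here refl) = NP.m≤m+n x (sum A)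
∈⇒≤sum {A = x ∷ A} (there y∈A) = NP.≤-trans (∈⇒≤sum y∈A) (NP.m≤n+m (sum A) x)

module Relabel (bij : ℕ ↔ ℕ) where

  σ σ⁻¹ : ℕ → ℕ
  σ   = Inverse.to bij
  σ⁻¹ = Inverse.from bij

  -- A′ is the image of A under σ.
  _↦_ : List ℕ → List ℕ → Set
  A ↦ A′ = ∀ x → (σ x ∈ A′) ⇔ (x ∈ A)

  -- The preimage σ⁻¹(A), as a canonical list; the preimage of A lies
  -- below 1 + Σ σ⁻¹(A), which makes it a finite search.
  preimage : List ℕ → List ℕ
  preimage A = filter (λ x → σ x ∈ℕ? A) (upTo (suc (sum (map σ⁻¹ A))))

  ∈-preimage : ∀ A x → (x ∈ preimage A) ⇔ (σ x ∈ A)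
  ∈-preimage A x = mk⇔ (λ x∈ → proj₂ (∈-filter⁻ (λ x → σ x ∈ℕ? A) x∈))
                       (λ σx∈ → ∈-filter⁺ (λ x → σ x ∈ℕ? A) (∈-upTo⁺ (s≤s (bounded σx∈))) σx∈)
    where
    bounded : σ x ∈ A → x ≤ sum (map σ⁻¹ A)
    bounded σx∈ = subst (_≤ sum (map σ⁻¹ A)) (Inverse.strictlyInverseʳ bij x)
                        (∈⇒≤sum (∈-map⁺ σ⁻¹ σx∈))

  preimage-canonical : ∀ A → CanonSet (preimage A)
  preimage-canonical A = LinkedP.filter⁺ (λ x → σ x ∈ℕ? A) NP.<-trans
    (LinkedP.applyUpTo⁺₂ id (suc (sum (map σ⁻¹ A))) NP.n<1+n)

  -- σ is surjective, so a canonical set is determined by its preimage.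
  preimage-injective : ∀ {A B} → CanonSet A → CanonSet B → preimage A ≡ preimage B → A ≡ B
  preimage-injective {A} {B} cA cB eq = canon-ext cA cB λ z →
    subst (λ w → (w ∈ A) ⇔ (w ∈ B)) (Inverse.strictlyInverseˡ bij z)
      (⇔-trans (⇔-sym (∈-preimage A (σ⁻¹ z)))
        (subst (λ C → (σ⁻¹ z ∈ C) ⇔ (σ (σ⁻¹ z) ∈ B)) (sym eq) (∈-preimage B (σ⁻¹ z))))

  preimages-unique : ∀ {H} → All CanonSet H → Unique H → Unique (map preimage H)
  preimages-unique []       []       = []
  preimages-unique {A ∷ _} (c ∷ cs) (u ∷ us) = distinct cs u ∷ preimages-unique cs us
    where
    distinct : ∀ {H} → All CanonSet H → All (λ B → ¬ A ≡ B) H →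
               All (λ B → ¬ preimage A ≡ B) (map preimage H)
    distinct []        []       = []
    distinct (c′ ∷ cs′) (v ∷ vs) = (λ e → v (preimage-injective c c′ e)) ∷ distinct cs′ vs

  -- Preimages commute with unions, so pulling back preserves union closure.
  preimages-unionClosed : ∀ {H} → UnionClosed H → UnionClosed (map preimage H)
  preimages-unionClosed {H} closed A′ B′ A′∈ B′∈
    with ∈-map⁻ preimage A′∈ | ∈-map⁻ preimage B′∈
  ... | A , A∈ , refl | B , B∈ , refl with closed A B A∈ B∈
  ... | C , C∈ , C≈A∪B = preimage C , ∈-map⁺ preimage C∈ , λ x →
    ⇔-trans (∈-preimage C x)
      (⇔-trans (C≈A∪B (σ x)) (⇔-sym (∈-preimage A x) ⊎-⇔ ⇔-sym (∈-preimage B x)))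

  preimages-include : ∀ {F F′ H} → (∀ {A} → A ∈ F → ∃ λ A′ → A′ ∈ F′ × A ↦ A′) →
    Includes H F′ → Includes (map preimage H) F
  preimages-include images incl A A∈ with images A∈
  ... | A′ , A′∈ , A↦A′ with incl A′ A′∈
  ... | B , B∈ , B≈A′ = preimage B , ∈-map⁺ preimage B∈ , λ x →
    ⇔-trans (∈-preimage B x) (⇔-trans (B≈A′ (σ x)) (A↦A′ x))

  count-preimage : ∀ a H → count a (map preimage H) ≡ count (σ a) H
  count-preimage a [] = refl
  count-preimage a (A ∷ H) with a ∈ℕ? preimage A | σ a ∈ℕ? A
  ... | yes _  | yes _   = cong suc (count-preimage a H)
  ... | yes a∈ | no σa∉  = ⊥-elim (σa∉ (to (∈-preimage A a) a∈))
  ... | no a∉  | yes σa∈ = ⊥-elim (a∉ (from (∈-preimage A a) σa∈))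
  ... | no _   | no _    = count-preimage a H

  -- If F′ contains a σ-image of every member of the FC-family F, then F′ is
  -- an FC-family: test F against the pullback of any G ⊇ F′.
  FC-relabel : ∀ {F F′} → (∀ {A} → A ∈ F → ∃ λ A′ → A′ ∈ F′ × A ↦ A′) →
    IsFCFamily F → IsFCFamily F′
  FC-relabel images fc G canonG uniqueG closedG inclG
    with fc (map preimage G) (AllP.map⁺ (All.universal preimage-canonical _))
            (preimages-unique canonG uniqueG) (preimages-unionClosed closedG)
            (preimages-include images inclG)
  ... | a , (A′ , A′∈ , a∈A′) , large with ∈-map⁻ preimage A′∈
  ... | A , A∈ , refl = σ a , (A , A∈ , to (∈-preimage A a) a∈A′) ,
    subst₂ (λ size c → size ≤ 2 * c) (length-map preimage G) (count-preimage a G) large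

!-∈ : ∀ p {i} → i < length p → p ! i ∈ p
!-∈ (y ∷ p) {zero}  _         = here refl
!-∈ (y ∷ p) {suc i} (s≤s i<) = there (!-∈ p i<)

∈⇒index : ∀ {p y} → y ∈ p → ∃ λ i → i < length p × p ! i ≡ y
∈⇒index (here refl) = zero , s≤s z≤n , refl
∈⇒index (there y∈) with ∈⇒index y∈
... | i , i< , e = suc i , s≤s i< , e

!-injective : ∀ {p} → Unique p → ∀ {i j} → i < length p → j < length p →
              p ! i ≡ p ! j → i ≡ j
!-injective {y ∷ p} (u ∷ us) {zero}  {zero}  _         _         _ = refl
!-injective {y ∷ p} (u ∷ us) {zero}  {suc j} _         (s≤s j<) e =
  ⊥-elim (All.lookup u (!-∈ p j<) e)
!-injective {y ∷ p} (u ∷ us) {suc i} {zero}  (s≤s i<) _         e =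
  ⊥-elim (All.lookup u (!-∈ p i<) (sym e))
!-injective {y ∷ p} (u ∷ us) {suc i} {suc j} (s≤s i<) (s≤s j<) e =
  cong suc (!-injective us i< j< e)

module PermutationBijection {n : ℕ} {p : List ℕ} (perm : IsPermutation n p) where

  length-p : length p ≡ n
  length-p = trans (PermP.↭-length perm) (length-upTo n)

  p-unique : Unique p
  p-unique = PermSP.Unique-resp-↭ (setoid ℕ) (↭⇒↭ₛ (↭-sym perm)) (UniqueP.upTo⁺ n)

  <length : ∀ {x} → x < n → x < length p
  <length = subst (_ <_) (sym length-p)

  !-< : ∀ {x} → x < n → p ! x < n
  !-< x<n = ∈-upTo⁻ (PermP.∈-resp-↭ perm (!-∈ p (<length x<n)))

  σ : ℕ → ℕ
  σ x with x <? n
  ... | yes _ = p ! x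
  ... | no  _ = x

  σ-< : ∀ {x} → x < n → σ x ≡ p ! x
  σ-< {x} x<n with x <? n
  ... | yes _   = refl
  ... | no  x≮n = ⊥-elim (x≮n x<n)

  σ-injective : ∀ {x y} → σ x ≡ σ y → x ≡ y
  σ-injective {x} {y} e with x <? n | y <? n
  ... | yes x<n | yes y<n = !-injective p-unique (<length x<n) (<length y<n) e
  ... | yes x<n | no  y≮n = ⊥-elim (y≮n (subst (_< n) e (!-< x<n)))
  ... | no  x≮n | yes y<n = ⊥-elim (x≮n (subst (_< n) (sym e) (!-< y<n)))
  ... | no  _   | no  _   = e

  σ-surjective : ∀ y → ∃ λ x → σ x ≡ y
  σ-surjective y with y <? n
  ... | no  y≮n = y , σ-≥ y≮n
    where
    σ-≥ : ∀ {x} → ¬ x < n → σ x ≡ x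
    σ-≥ {x} x≮n with x <? n
    ... | yes x<n = ⊥-elim (x≮n x<n)
    ... | no  _   = refl
  ... | yes y<n with ∈⇒index (PermP.∈-resp-↭ (↭-sym perm) (∈-upTo⁺ y<n))
  ...   | i , i< , e = i , trans (σ-< (subst (i <_) length-p i<)) e

  bijection : ℕ ↔ ℕ
  bijection = ⤖⇒↔ (mk⤖ (σ-injective , strictlySurjective⇒surjective σ-surjective))

  σ-perm-set : ∀ {A} → All (_< n) A → ∀ x → (σ x ∈ perm-set A p) ⇔ (x ∈ A)
  σ-perm-set {A} A<n x = mk⇔ image⇒ ⇒image
    where
    sorted↭ = SortP.sort-↭ NP.≤-decTotalOrder (map (p !_) A)

    image⇒ : σ x ∈ perm-set A p → x ∈ A
    image⇒ σx∈ with ∈-map⁻ (p !_) (PermP.∈-resp-↭ sorted↭ σx∈)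
    ... | a , a∈ , e =
      subst (_∈ A) (σ-injective (trans (σ-< (All.lookup A<n a∈)) (sym e))) a∈

    ⇒image : x ∈ A → σ x ∈ perm-set A p
    ⇒image x∈ = PermP.∈-resp-↭ (↭-sym sorted↭)
      (subst (_∈ map (p !_) A) (sym (σ-< (All.lookup A<n x∈))) (∈-map⁺ (p !_) x∈))

perm-family-FC : ∀ {n p F} → IsPermutation n p → All (All (_< n)) F →
  IsFCFamily F → IsFCFamily (perm-family F p)
perm-family-FC {n} {p} {F} perm F<n = FC-relabel images
  where
  open PermutationBijection perm using (bijection; σ-perm-set)
  open Relabel bijection using (FC-relabel; _↦_)

  images : ∀ {A} → A ∈ F → ∃ λ A′ → A′ ∈ perm-family F p × A ↦ A′
  images {A} A∈ = perm-set A p ,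
    PermP.∈-resp-↭ (↭-sym (SortP.sort-↭ (Lex.≤-decTotalOrder NP.≤-decTotalOrder) _))
      (∈-map⁺ (λ B → perm-set B p) A∈) ,
    σ-perm-set (All.lookup F<n A∈)

orbit-member : ∀ F {P G} → G ∈ orbit F P → ∃ λ p → p ∈ P × G ≡ perm-family F p
orbit-member F {P} G∈ =
  ∈-map⁻ (perm-family F) (∈-deduplicate⁻ (≡-dec (≡-dec NP._≟_)) (map (perm-family F) P) G∈)

OrbitClosed : (List (List ℕ) → Set) → List (List ℕ) → List (List ℕ) → Set
OrbitClosed Q P F = ∀ {p} → p ∈ P → Q F → Q (perm-family F p)

-- If Q holds on the output of nef′ (with enough fuel) and is carried along
-- orbits, then it holds on the accumulator and on the whole input: each
-- discarded family lies in the orbit of a kept one.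
nef′-reflects : ∀ (Q : List (List ℕ) → Set) {P} fuel Fs Fr →
  length Fs ≤ fuel → All (OrbitClosed Q P) Fs →
  All Q (nef′ fuel Fs P Fr) → All Q Fr × All Q Fs
nef′-reflects Q zero       []       Fr _        _ QFr = QFr , []
nef′-reflects Q (suc fuel) []       Fr _        _ QFr = QFr , []
nef′-reflects Q {P} (suc fuel) (F ∷ Fs) Fr (s≤s len) (closedF ∷ closedFs) Qnef
  with nef′-reflects Q fuel (filter outside? Fs) (F ∷ Fr)
         (NP.≤-trans (length-filter outside? Fs) len) (AllP.filter⁺ outside? closedFs) Qnef
  where
  outside? : ∀ G → Dec (¬ G ∈ orbit F P)
  outside? G = ¬? (G ∈F? orbit F P)
... | QF ∷ QFr , Qoutside = QFr , QF ∷ AllP.filter⁻ (_∈F? orbit F P) Qinside Qoutside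
  where
  Qinside : All Q (filter (_∈F? orbit F P) Fs)
  Qinside = All.tabulate λ G∈ → case-orbit (proj₂ (∈-filter⁻ (_∈F? orbit F P) {xs = Fs} G∈))
    where
    case-orbit : ∀ {G} → G ∈ orbit F P → Q G
    case-orbit G∈ with orbit-member F G∈
    ... | p , p∈ , refl = closedF p∈ QF

lemma7 : (n k m : ℕ) (𝓕 : List (List (List ℕ))) (P : List (List ℕ)) →
    All (λ F → F ∈ families n k m) 𝓕 →
    All (IsPermutation n) P →
    All IsFCFamily (nef 𝓕 P) →
    All IsFCFamily 𝓕
lemma7 n k m 𝓕 P 𝓕⊆families perms FCnef =
  proj₂ (nef′-reflects IsFCFamily (length 𝓕) 𝓕 [] NP.≤-refl
           (All.map orbit-closed 𝓕⊆families) FCnef)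
  where
  orbit-closed : ∀ {F} → F ∈ families n k m → OrbitClosed IsFCFamily P F
  orbit-closed F∈ p∈ = perm-family-FC (All.lookup perms p∈) (families-bounded n k m F∈)
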